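{- Work in intuitionistic set theory (e.g. IZF or CZF, with the axiom of infinity, without excluded middle). Suppose that for all sets $A$ and $B$, whenever $A$ is nonempty (i.e. inhabited) and there is an injective function $f : A \to B$, there is a surjective function $g : B \to A$. Then excluded middle holds: for every proposition $p$, $p \vee \neg p$.
   Context: The ambient theory is a constructive set theory (e.g. IZF or CZF) satisfying the axioms of Zermelo set theory and the axiom of infinity, without assuming excluded middle. -}

module Defs where

open import Data.Product using (Σ; ∃; _,_)
open import Relation.Binary.PropositionalEquality using (_≡_)

Inhabited : Set → Set
Inhabited A = A

IsInjective : {A B : Set} → (A → B) → Set
IsInjective {A} f = ∀ (x y : A) → f x ≡ f y → x ≡ y

IsSurjective : {A B : Set} → (B → A) → Set
IsSurjective {A} {B} g = ∀ (a : A) → ∃ λ (b : B) → g b ≡ a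

IsProp : Set → Set
IsProp P = ∀ (x y : P) → x ≡ y

InjToSurj : Set₁
InjToSurj = ∀ (A B : Set) → Inhabited A → (f : A → B) → IsInjective f →
  Σ (B → A) IsSurjective

module Submission where

-- The argument (Diaconescu-style, but with an injection in place of
-- choice) runs through the inhabited set ⊤ ⊎ P:
--   * the tag map ⊤ ⊎ P → Bool sending inj₁ to false and inj₂ to true
--     is injective, because both summands are propositions
--     (tag-injective);
--   * a surjection Bool → X ⊎ Y decides Y, since Bool has only two
--     elements to inspect: either one of them lands in the right summand,
--     or none does and then nothing in Y can be hit (surjection-decides).
-- The hypothesis turns the injection of the first step into a surjection
-- Bool → ⊤ ⊎ P, which decides P by the second step.

open import Defs
open import Data.Empty using (⊥)
open import Data.Bool using (Bool; true; false)
open import Data.Product using (Σ; _,_)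
open import Data.Sum using (_⊎_; inj₁; inj₂)
open import Data.Unit using (⊤; tt)
open import Relation.Nullary using (¬_)
open import Relation.Binary.PropositionalEquality using (_≡_; _≢_; refl; cong)

tag : {X Y : Set} → X ⊎ Y → Bool
tag (inj₁ _) = false
tag (inj₂ _) = true

tag-injective : {X Y : Set} → IsProp X → IsProp Y → IsInjective (tag {X} {Y})
tag-injective propX propY (inj₁ x) (inj₁ x′) _ = cong inj₁ (propX x x′)
tag-injective propX propY (inj₂ y) (inj₂ y′) _ = cong inj₂ (propY y y′)
tag-injective propX propY (inj₁ _) (inj₂ _) ()
tag-injective propX propY (inj₂ _) (inj₁ _) ()

right-or-not : {X Y : Set} (s : X ⊎ Y) → Y ⊎ (∀ y → s ≢ inj₂ y)
right-or-not (inj₁ _) = inj₂ λ _ ()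
right-or-not (inj₂ y) = inj₁ y

-- A surjection from Bool onto X ⊎ Y decides Y: inspect both values.
-- If neither is a right injection, surjectivity at inj₂ y yields a
-- boolean whose image is one, which is absurd.
surjection-decides : {X Y : Set} (g : Bool → X ⊎ Y) → IsSurjective g → Y ⊎ ¬ Y
surjection-decides {Y = Y} g surj with right-or-not (g true) | right-or-not (g false)
... | inj₁ y | _      = inj₁ y
... | inj₂ _ | inj₁ y = inj₁ y
... | inj₂ true-misses | inj₂ false-misses = inj₂ λ y → missed y (surj (inj₂ y))
  where
  missed : (y : Y) → Σ Bool (λ b → g b ≡ inj₂ y) → ⊥
  missed y (true  , gb≡y) = true-misses  y gb≡y
  missed y (false , gb≡y) = false-misses y gb≡y

⊤-isProp : IsProp ⊤
⊤-isProp tt tt = refl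

proposition3 : InjToSurj → ∀ (P : Set) → IsProp P → P ⊎ ¬ P
proposition3 injToSurj P propP
  with injToSurj (⊤ ⊎ P) Bool (inj₁ tt) tag (tag-injective ⊤-isProp propP)
... | g , surj = surjection-decides g surj
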